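{- The modal logic $12$g is strongly complete for the class of all non-degenerate projective $1$-planes: every $12$g-consistent set of modal formulas is satisfiable in some model on some non-degenerate projective $1$-plane.
   Context: Modal formulas are built from countably many propositional variables with $\neg,\wedge,\Box$; $\Diamond=\neg\Box\neg$, $\Box^n$ is $n$-fold $\Box$. A $1$-frame is $(X,I)$ with $I\subseteq X\times X$; a model is a $1$-frame with a valuation $V$ assigning to each variable a subset of $X$; truth at a point is defined as usual, with $\Box\varphi$ true at $a$ iff $\varphi$ is true at all $b$ with $aIb$. A set of formulas is satisfiable in a model if all its members are true at some common point. A normal logic is a set of formulas containing all tautologies and all instances of $\Box(\varphi\to\psi)\to(\Box\varphi\to\Box\psi)$, closed under modus ponens and the rule from $\varphi$ infer $\Box\varphi$. $12$g is the smallest normal logic containing all instances of $\Box\varphi\to\Diamond\varphi$, $\Diamond\Box\varphi\to\varphi$, and $\Box\Box\varphi\to\Box\Box\Box\Box\varphi$. A set $\Sigma$ is $\Lambda$-consistent if for no finite conjunction $\varphi$ of members of $\Sigma$ is $\neg\varphi\in\Lambda$. A $1$-plane is a $1$-frame satisfying O1: $aI^4b$ implies $aI^2b$; O2: for all $a,b$, $aI^2b$ or $aI^3b$; O3: $aIbIcIdIa$ implies $a=c$ or $b=d$ (here $I^n$ is $n$-fold composition). In a $1$-plane $I^2$ is an equivalence relation; the plane is projective if it has exactly two $I^2$-classes, and non-degenerate if O4 holds: there exist $a,b,c,d,e,f$ with $aIbIcId$ and $eIf$, not $aId$, and none of $a,b,c,d$ incident with $e$ or $f$. -}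

module Defs where

open import Data.Nat using (ℕ; zero; suc)
open import Data.List using (List; []; _∷_)
open import Data.List.Relation.Unary.All using (All)
open import Data.Product using (Σ; ∃; _×_; _,_)
open import Data.Sum using (_⊎_)
open import Relation.Nullary using (¬_)
open import Relation.Binary.PropositionalEquality using (_≡_)

data Fm : Set where
  var  : ℕ → Fm
  ¬′_  : Fm → Fm
  _∧′_ : Fm → Fm → Fm
  □_   : Fm → Fm

infixr 6 _∧′_
infix  7 ¬′_ □_ ◇_
infixr 5 _∨′_
infixr 4 _→′_

_∨′_ : Fm → Fm → Fm
φ ∨′ ψ = ¬′ (¬′ φ ∧′ ¬′ ψ)

_→′_ : Fm → Fm → Fm
φ →′ ψ = ¬′ (φ ∧′ ¬′ ψ)

◇_ : Fm → Fm
◇ φ = ¬′ □ ¬′ φ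

⊤′ : Fm
⊤′ = ¬′ (var 0 ∧′ ¬′ var 0)

⋀ : List Fm → Fm
⋀ []       = ⊤′
⋀ (φ ∷ []) = φ
⋀ (φ ∷ φs) = φ ∧′ ⋀ φs

-- Tautologies: formulas true under every classical (Bool) valuation of
-- their maximal □-subformulas and variables.

open import Data.Bool using (Bool; true; false; not; _∧_)

record PVal : Set where
  field
    pv : ℕ → Bool
    pb : Fm → Bool

evalP : PVal → Fm → Bool
evalP v (var n)  = PVal.pv v n
evalP v (¬′ φ)   = not (evalP v φ)
evalP v (φ ∧′ ψ) = evalP v φ ∧ evalP v ψ
evalP v (□ φ)    = PVal.pb v φ

Tautology : Fm → Set
Tautology φ = (v : PVal) → evalP v φ ≡ true

data 12g : Fm → Set where
  taut : ∀ {φ} → Tautology φ → 12g φ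
  axK  : ∀ φ ψ → 12g (□ (φ →′ ψ) →′ (□ φ →′ □ ψ))
  axD  : ∀ φ → 12g (□ φ →′ ◇ φ)
  axB  : ∀ φ → 12g (◇ □ φ →′ φ)
  ax24 : ∀ φ → 12g (□ □ φ →′ □ □ □ □ φ)
  mp   : ∀ {φ ψ} → 12g φ → 12g (φ →′ ψ) → 12g ψ
  nec  : ∀ {φ} → 12g φ → 12g (□ φ)

Consistent : (Fm → Set) → Set
Consistent S = (φs : List Fm) → All S φs → ¬ 12g (¬′ ⋀ φs)

record Frame : Set₁ where
  field
    X : Set
    I : X → X → Set

Iter : {X : Set} → (X → X → Set) → ℕ → X → X → Set
Iter I zero    a b = a ≡ b
Iter I (suc n) a b = ∃ λ c → I a c × Iter I n c b

module _ (F : Frame) where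
  open Frame F

  O1 : Set
  O1 = ∀ a b → Iter I 4 a b → Iter I 2 a b

  O2 : Set
  O2 = ∀ a b → Iter I 2 a b ⊎ Iter I 3 a b

  O3 : Set
  O3 = ∀ a b c d → I a b → I b c → I c d → I d a → a ≡ c ⊎ b ≡ d

  Is1Plane : Set
  Is1Plane = O1 × O2 × O3

  -- exactly two I²-classes
  Projective : Set
  Projective = Σ X λ x → Σ X λ y →
                 ¬ Iter I 2 x y × (∀ z → Iter I 2 z x ⊎ Iter I 2 z y)

  Incident : X → X → Set
  Incident x y = I x y ⊎ I y x

  NonDegenerate : Set
  NonDegenerate =
    Σ X λ a → Σ X λ b → Σ X λ c → Σ X λ d → Σ X λ e → Σ X λ f →
      I a b × I b c × I c d × I e f × ¬ I a d ×
      ¬ Incident a e × ¬ Incident a f ×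
      ¬ Incident b e × ¬ Incident b f ×
      ¬ Incident c e × ¬ Incident c f ×
      ¬ Incident d e × ¬ Incident d f

  Holds : (ℕ → X → Set) → X → Fm → Set
  Holds V a (var n)  = V n a
  Holds V a (¬′ φ)   = ¬ Holds V a φ
  Holds V a (φ ∧′ ψ) = Holds V a φ × Holds V a ψ
  Holds V a (□ φ)    = ∀ b → I a b → Holds V b φ

  SatisfiableIn : (ℕ → X → Set) → (Fm → Set) → Set
  SatisfiableIn V S = Σ X λ a → ∀ φ → S φ → Holds V a φ

{-# OPTIONS --safe #-}
-- The plane is built in stages, every point labelled by a maximal 12g-consistent theory; stage 0 is
-- one point labelled by a Lindenbaum extension of S. A point added at stage n + 1 is either a witness
-- for (s, ψ), adjacent to s and labelled by an extension of {φ | □φ ∈ s} together with ψ if ◇ψ ∈ s, or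
-- a join of two points p, q of equal sort (parity of the distance to the root) that have no common
-- neighbour yet, labelled by an extension of {φ | □φ ∈ p} ∪ {φ | □φ ∈ q}. Incident points are then
-- related by the canonical relation of □, which is symmetric by B, and the witnesses give the truth
-- lemma. By D, B and □□φ → □□□□φ, the relation "□□φ ∈ Γ implies φ ∈ Δ" is an equivalence on maximal
-- consistent theories relating the labels of all points of equal sort, which makes the labels of joins
-- consistent. Points of equal sort are at distance 2, through a common neighbour or their join (O1,
-- O2, projectivity), and in a quadrilateral with distinct diagonals the youngest vertex is the join of
-- its two neighbours, so the opposite vertex is either an older common neighbour of them or the same
-- join (O3).
module Submission where

open import Defs
open import Axiom.ExcludedMiddle using (ExcludedMiddle)
open import Level using (0ℓ)
open import Data.Bool using (Bool; true; false; not; _∧_)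
open import Data.Bool.Properties using (not-involutive; ¬-not)
import Data.Bool as Bool
open import Data.Empty using (⊥; ⊥-elim)
open import Data.Empty.Irrelevant using () renaming (⊥-elim to ⊥-elimᵢ)
open import Data.Unit using (⊤; tt)
open import Data.List using (List; []; _∷_; map; _++_; foldl; cartesianProductWith)
open import Data.List.Membership.Propositional using (_∈_)
open import Data.List.Membership.Propositional.Properties
  using (∈-++⁺ˡ; ∈-++⁺ʳ; ∈-map⁺; ∈-cartesianProductWith⁺)
open import Data.List.Relation.Binary.Subset.Propositional using () renaming (_⊆_ to _⊆ₗ_)
open import Data.List.Relation.Binary.Subset.Propositional.Properties using (xs⊆xs++ys)
open import Data.List.Relation.Unary.Any using (here; there)
open import Data.List.Relation.Unary.All as All using (All; []; _∷_)
open import Data.List.Relation.Unary.All.Properties using (map⁺; ++⁺; ++⁻)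
open import Data.Nat using (ℕ; zero; suc; _⊔_; _≤_; _<_; z≤n; s≤s; _≤′_; ≤′-refl; ≤′-step)
open import Data.Nat.Properties
  using (≤⇒≤′; ≤-total; ≤-trans; m≤m⊔n; m≤n⊔m; ≤-refl; ≤-pred; m≤n⇒m≤1+n; 1+n≰n; <-irrefl; <-≤-trans; <⇒≱
        ; ≤∧≢⇒<; _≟_)
open import Data.Product using (Σ; ∃; ∃₂; _×_; _,_; proj₁; proj₂)
open import Data.Sum using (_⊎_; inj₁; inj₂; [_,_]; swap) renaming (map to ⊎-map)
open import Function using (id; _∘_; case_of_; _⇔_; mk⇔; Equivalence)
open import Relation.Nullary using (¬_; Dec; yes; no; recompute)
open import Relation.Binary.PropositionalEquality using (_≡_; _≢_; refl; sym; trans; cong; subst; subst₂)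

private variable
  v : PVal
  φ ψ χ : Fm
  φs αs βs : List Fm
  i j : ℕ

record _⊨_ (v : PVal) (φ : Fm) : Set where
  constructor ⊨-intro
  field ⊨-elim : evalP v φ ≡ true
open _⊨_

infix 3.5 _⊨_

_⊨?_ : (v : PVal) (φ : Fm) → Dec (v ⊨ φ)
v ⊨? φ with evalP v φ Bool.≟ true
... | yes e = yes (⊨-intro e)
... | no ne = no (ne ∘ ⊨-elim)

private
  not-true⁺ : ∀ {b} → ¬ b ≡ true → not b ≡ true
  not-true⁺ {true}  h = ⊥-elim (h refl)
  not-true⁺ {false} _ = refl

  not-true⁻ : ∀ {b} → not b ≡ true → ¬ b ≡ true
  not-true⁻ {true} () _

  ∧-true⁺ : ∀ {a b} → a ≡ true → b ≡ true → a ∧ b ≡ true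
  ∧-true⁺ refl refl = refl

  ∧-true⁻ : ∀ {a b} → a ∧ b ≡ true → a ≡ true × b ≡ true
  ∧-true⁻ {true} h = refl , h

¬⁺ : ¬ v ⊨ φ → v ⊨ ¬′ φ
¬⁺ h = ⊨-intro (not-true⁺ (h ∘ ⊨-intro))

¬⁻ : v ⊨ ¬′ φ → ¬ v ⊨ φ
¬⁻ (⊨-intro h) (⊨-intro g) = not-true⁻ h g

∧⁺ : v ⊨ φ → v ⊨ ψ → v ⊨ φ ∧′ ψ
∧⁺ (⊨-intro p) (⊨-intro q) = ⊨-intro (∧-true⁺ p q)

∧⁻ : v ⊨ φ ∧′ ψ → v ⊨ φ × v ⊨ ψ
∧⁻ (⊨-intro h) = let p , q = ∧-true⁻ h in ⊨-intro p , ⊨-intro q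

¬¬⁻ : v ⊨ ¬′ ¬′ φ → v ⊨ φ
¬¬⁻ {v} {φ} h with v ⊨? φ
... | yes p = p
... | no np = ⊥-elim (¬⁻ h (¬⁺ np))

→⁺ : (v ⊨ φ → v ⊨ ψ) → v ⊨ φ →′ ψ
→⁺ f = ¬⁺ λ h → let p , nq = ∧⁻ h in ¬⁻ nq (f p)

→⁻ : v ⊨ φ →′ ψ → v ⊨ φ → v ⊨ ψ
→⁻ {v} {ψ = ψ} h p with v ⊨? ψ
... | yes q = q
... | no nq = ⊥-elim (¬⁻ h (∧⁺ p (¬⁺ nq)))

⊤⁺ : v ⊨ ⊤′
⊤⁺ = ¬⁺ λ h → let p , np = ∧⁻ h in ¬⁻ np p

⋀⁺ : All (v ⊨_) φs → v ⊨ ⋀ φs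
⋀⁺ []               = ⊤⁺
⋀⁺ (p ∷ [])         = p
⋀⁺ (p ∷ ps@(_ ∷ _)) = ∧⁺ p (⋀⁺ ps)

⋀⁻ : v ⊨ ⋀ φs → All (v ⊨_) φs
⋀⁻ {φs = []}        _ = []
⋀⁻ {φs = _ ∷ []}    p = p ∷ []
⋀⁻ {φs = _ ∷ _ ∷ _} p = let q , qs = ∧⁻ p in q ∷ ⋀⁻ qs

12g-taut : (∀ {v} → v ⊨ φ) → 12g φ
12g-taut h = taut λ _ → ⊨-elim h

12g-taut₁ : 12g φ → (∀ {v} → v ⊨ φ → v ⊨ ψ) → 12g ψ
12g-taut₁ p h = mp p (12g-taut (→⁺ h))

12g-taut₂ : 12g φ → 12g ψ → (∀ {v} → v ⊨ φ → v ⊨ ψ → v ⊨ χ) → 12g χ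
12g-taut₂ p q h = mp q (mp p (12g-taut (→⁺ λ a → →⁺ λ b → h a b)))

12g-trans : 12g (φ →′ ψ) → 12g (ψ →′ χ) → 12g (φ →′ χ)
12g-trans p q = 12g-taut₂ p q λ f g → →⁺ (→⁻ g ∘ →⁻ f)

□-mono : 12g (φ →′ ψ) → 12g (□ φ →′ □ ψ)
□-mono {φ} {ψ} h = mp (nec h) (axK φ ψ)

¬¬-intro : 12g (φ →′ ¬′ ¬′ φ)
¬¬-intro = 12g-taut (→⁺ λ p → ¬⁺ λ ¬p → ¬⁻ ¬p p)

contraposition : 12g (φ →′ ψ) → 12g (¬′ ψ →′ ¬′ φ)
contraposition f = 12g-taut₁ f λ g → →⁺ λ ¬q → ¬⁺ (¬⁻ ¬q ∘ →⁻ g)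

¬¬-elim : 12g (¬′ ¬′ φ →′ φ)
¬¬-elim = 12g-taut (→⁺ ¬¬⁻)

axB-dual : ∀ φ → 12g (φ →′ □ ◇ φ)
axB-dual φ = 12g-taut₁ (axB (¬′ φ)) λ f → →⁺ λ p → ¬¬⁻ (¬⁺ λ ¬□◇φ → ¬⁻ (→⁻ f ¬□◇φ) p)

◇-mono : 12g (φ →′ ψ) → 12g (◇ φ →′ ◇ ψ)
◇-mono = contraposition ∘ □-mono ∘ contraposition

¬□⇒◇¬ : 12g (¬′ □ φ →′ ◇ ¬′ φ)
¬□⇒◇¬ = contraposition (□-mono ¬¬-elim)

□-⋀ : ∀ αs {χ} → 12g (⋀ αs →′ χ) → 12g (⋀ (map □_ αs) →′ □ χ)
□-⋀ []       h = 12g-taut₁ (nec (12g-taut₁ h (λ f → →⁻ f ⊤⁺))) (λ p → →⁺ λ _ → p)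
□-⋀ (α ∷ αs) {χ} h =
  12g-taut₂ (□-⋀ αs (12g-taut₁ h λ f → →⁺ λ as → →⁺ λ a → →⁻ f (⋀⁺ (a ∷ ⋀⁻ {φs = αs} as))))
            (axK α χ)
            λ f k → →⁺ λ bs → case ⋀⁻ {φs = □ α ∷ map □_ αs} bs of λ where
              (b ∷ bs′) → →⁻ (→⁻ k (→⁻ f (⋀⁺ bs′))) b

-- Consistent and maximal consistent theories

Theory : Set₁
Theory = Fm → Set

private variable
  Γ Δ Θ A B : Theory

｛_｝ : Fm → Theory
｛ φ ｝ = _≡ φ

_∪_ : Theory → Theory → Theory
(A ∪ B) φ = A φ ⊎ B φ

_⊆_ : Theory → Theory → Set
A ⊆ B = ∀ {φ} → A φ → B φ

All-∪-split : All (A ∪ B) φs →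
  ∃₂ λ αs βs → All A αs × All B βs × (∀ {P : Fm → Set} → All P αs → All P βs → All P φs)
All-∪-split [] = [] , [] , [] , [] , λ _ _ → []
All-∪-split (inj₁ a ∷ ps) =
  let αs , βs , as , bs , h = All-∪-split ps
  in _ ∷ αs , βs , a ∷ as , bs , λ { (p ∷ qs) rs → p ∷ h qs rs }
All-∪-split (inj₂ b ∷ ps) =
  let αs , βs , as , bs , h = All-∪-split ps
  in αs , _ ∷ βs , as , b ∷ bs , λ { qs (p ∷ rs) → p ∷ h qs rs }

All-｛｝ : {P : Fm → Set} → All ｛ φ ｝ φs → P φ → All P φs
All-｛｝ []           _ = []
All-｛｝ (refl ∷ eqs) p = p ∷ All-｛｝ eqs p

consistent-∪-¬ : Consistent Γ → ¬ Consistent (Γ ∪ ｛ φ ｝) → Consistent (Γ ∪ ｛ ¬′ φ ｝)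
consistent-∪-¬ {Γ} {φ} cΓ ¬cΓφ ψs pψs ⊢¬ψs = ¬cΓφ λ φs pφs ⊢¬φs →
  let α₁ , β₁ , a₁ , b₁ , h₁ = All-∪-split pφs
      α₂ , β₂ , a₂ , b₂ , h₂ = All-∪-split pψs
  in cΓ (α₁ ++ α₂) (++⁺ a₁ a₂) (12g-taut₂ ⊢¬φs ⊢¬ψs λ {v} ¬φs ¬ψs → ¬⁺ λ as →
       let as₁ , as₂ = ++⁻ α₁ (⋀⁻ {φs = α₁ ++ α₂} as) in
       case v ⊨? φ of λ where
         (yes p)  → ¬⁻ ¬φs (⋀⁺ (h₁ as₁ (All-｛｝ b₁ p)))
         (no ¬p) → ¬⁻ ¬ψs (⋀⁺ (h₂ as₂ (All-｛｝ b₂ (¬⁺ ¬p)))))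

record MaximalConsistent (Γ : Theory) : Set where
  field
    consistent : Consistent Γ
    complete   : ∀ φ → Γ φ ⊎ Γ (¬′ φ)

  taut-closed : All Γ φs → (∀ {v} → All (v ⊨_) φs → v ⊨ ψ) → Γ ψ
  taut-closed {φs} {ψ} ps h with complete ψ
  ... | inj₁ p  = p
  ... | inj₂ ¬p = ⊥-elim (consistent (¬′ ψ ∷ φs) (¬p ∷ ps) (12g-taut (¬⁺ λ qs →
                    case ⋀⁻ {φs = ¬′ ψ ∷ φs} qs of λ where (q ∷ qs′) → ¬⁻ q (h qs′))))

  theorem : 12g φ → Γ φ
  theorem {φ} p with complete φ
  ... | inj₁ q  = q
  ... | inj₂ ¬q = ⊥-elim (consistent (¬′ φ ∷ []) (¬q ∷ []) (12g-taut₁ p λ q → ¬⁺ (λ ¬q → ¬⁻ ¬q q)))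

  modus-ponens : Γ φ → Γ (φ →′ ψ) → Γ ψ
  modus-ponens p f = taut-closed (p ∷ f ∷ []) λ { (q ∷ g ∷ []) → →⁻ g q }

  closed : 12g (φ →′ ψ) → Γ φ → Γ ψ
  closed f p = modus-ponens p (theorem f)

  ¬-intro : ¬ Γ φ → Γ (¬′ φ)
  ¬-intro {φ} ¬p with complete φ
  ... | inj₁ p = ⊥-elim (¬p p)
  ... | inj₂ q = q

  ¬-elim : Γ (¬′ φ) → ¬ Γ φ
  ¬-elim {φ} ¬p p = consistent (φ ∷ ¬′ φ ∷ []) (p ∷ ¬p ∷ [])
                      (12g-taut (¬⁺ λ h → let q , ¬q = ∧⁻ h in ¬⁻ ¬q q))

  ∧-intro : Γ φ → Γ ψ → Γ (φ ∧′ ψ)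
  ∧-intro p q = taut-closed (p ∷ q ∷ []) λ { (p′ ∷ q′ ∷ []) → ∧⁺ p′ q′ }

  ∧-elim : Γ (φ ∧′ ψ) → Γ φ × Γ ψ
  ∧-elim p = taut-closed (p ∷ []) (proj₁ ∘ ∧⁻ ∘ All.head) , taut-closed (p ∷ []) (proj₂ ∘ ∧⁻ ∘ All.head)

  ⋀-intro : All Γ φs → Γ (⋀ φs)
  ⋀-intro ps = taut-closed ps ⋀⁺

formulas : ℕ → List Fm
formulas zero    = []
formulas (suc d) = let fs = formulas d in
  fs ++ var d ∷ map ¬′_ fs ++ map □_ fs ++ cartesianProductWith _∧′_ fs fs

formulas-mono : i ≤′ j → formulas i ⊆ₗ formulas j
formulas-mono ≤′-refl        = id
formulas-mono (≤′-step i≤′j) = xs⊆xs++ys _ _ ∘ formulas-mono i≤′j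

formulas-complete : ∀ φ → ∃ λ d → φ ∈ formulas d
formulas-complete (var n) = suc n , ∈-++⁺ʳ (formulas n) (here refl)
formulas-complete (¬′ φ) =
  let d , p = formulas-complete φ
  in suc d , ∈-++⁺ʳ (formulas d) (there (∈-++⁺ˡ (∈-map⁺ ¬′_ p)))
formulas-complete (□ φ) =
  let d , p = formulas-complete φ
  in suc d , ∈-++⁺ʳ (formulas d) (there (∈-++⁺ʳ (map ¬′_ (formulas d)) (∈-++⁺ˡ (∈-map⁺ □_ p))))
formulas-complete (φ ∧′ ψ) =
  let d , p = formulas-complete φ
      e , q = formulas-complete ψ
      fs = formulas (d ⊔ e)
  in suc (d ⊔ e) , ∈-++⁺ʳ fs (there (∈-++⁺ʳ (map ¬′_ fs) (∈-++⁺ʳ (map □_ fs)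
       (∈-cartesianProductWith⁺ _∧′_ (formulas-mono (≤⇒≤′ (m≤m⊔n d e)) p)
                                      (formulas-mono (≤⇒≤′ (m≤n⊔m d e)) q)))))

module Lindenbaum (em : ExcludedMiddle 0ℓ) where

  decide : Theory → Fm → Theory
  decide Γ φ with em {Consistent (Γ ∪ ｛ φ ｝)}
  ... | yes _ = Γ ∪ ｛ φ ｝
  ... | no _  = Γ ∪ ｛ ¬′ φ ｝

  decide-⊇ : ∀ Γ φ → Γ ⊆ decide Γ φ
  decide-⊇ Γ φ p with em {Consistent (Γ ∪ ｛ φ ｝)}
  ... | yes _ = inj₁ p
  ... | no _  = inj₁ p

  decide-consistent : ∀ Γ φ → Consistent Γ → Consistent (decide Γ φ)
  decide-consistent Γ φ c with em {Consistent (Γ ∪ ｛ φ ｝)}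
  ... | yes c′ = c′
  ... | no ¬c′ = consistent-∪-¬ c ¬c′

  decide-decides : ∀ Γ φ → decide Γ φ φ ⊎ decide Γ φ (¬′ φ)
  decide-decides Γ φ with em {Consistent (Γ ∪ ｛ φ ｝)}
  ... | yes _ = inj₁ (inj₂ refl)
  ... | no _  = inj₂ (inj₂ refl)

  decideAll : Theory → List Fm → Theory
  decideAll = foldl decide

  decideAll-⊇ : ∀ Γ φs → Γ ⊆ decideAll Γ φs
  decideAll-⊇ Γ []       = id
  decideAll-⊇ Γ (φ ∷ φs) = decideAll-⊇ (decide Γ φ) φs ∘ decide-⊇ Γ φ

  decideAll-consistent : ∀ Γ φs → Consistent Γ → Consistent (decideAll Γ φs)
  decideAll-consistent Γ []       = id
  decideAll-consistent Γ (φ ∷ φs) = decideAll-consistent (decide Γ φ) φs ∘ decide-consistent Γ φ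

  decideAll-decides : ∀ Γ φs → φ ∈ φs → decideAll Γ φs φ ⊎ decideAll Γ φs (¬′ φ)
  decideAll-decides Γ (φ ∷ φs) (here refl) with decide-decides Γ φ
  ... | inj₁ p = inj₁ (decideAll-⊇ _ φs p)
  ... | inj₂ p = inj₂ (decideAll-⊇ _ φs p)
  decideAll-decides Γ (ψ ∷ φs) (there p) = decideAll-decides (decide Γ ψ) φs p

  chain : Theory → ℕ → Theory
  chain Γ zero    = Γ
  chain Γ (suc d) = decideAll (chain Γ d) (formulas d)

  chain-mono : ∀ Γ → i ≤′ j → chain Γ i ⊆ chain Γ j
  chain-mono Γ ≤′-refl            = id
  chain-mono Γ (≤′-step {j} i≤′j) = decideAll-⊇ (chain Γ j) (formulas j) ∘ chain-mono Γ i≤′j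

  chain-consistent : ∀ Γ d → Consistent Γ → Consistent (chain Γ d)
  chain-consistent Γ zero    = id
  chain-consistent Γ (suc d) = decideAll-consistent _ (formulas d) ∘ chain-consistent Γ d

  maximise : Theory → Theory
  maximise Γ φ = ∃ λ d → chain Γ d φ

  maximise-⊇ : ∀ Γ → Γ ⊆ maximise Γ
  maximise-⊇ Γ p = zero , p

  All-maximise-bounded : ∀ Γ → All (maximise Γ) φs → ∃ λ d → All (chain Γ d) φs
  All-maximise-bounded Γ [] = zero , []
  All-maximise-bounded Γ ((d , p) ∷ ps) =
    let e , qs = All-maximise-bounded Γ ps
    in d ⊔ e , chain-mono Γ (≤⇒≤′ (m≤m⊔n d e)) p ∷ All.map (chain-mono Γ (≤⇒≤′ (m≤n⊔m d e))) qs

  maximise-maximal : ∀ Γ → Consistent Γ → MaximalConsistent (maximise Γ)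
  maximise-maximal Γ c = record
    { consistent = λ φs ps → let d , qs = All-maximise-bounded Γ ps in chain-consistent Γ d c φs qs
    ; complete   = λ φ → let d , p = formulas-complete φ in
        ⊎-map (suc d ,_) (suc d ,_) (decideAll-decides (chain Γ d) (formulas d) p)
    }

-- Canonical relations

□² : Fm → Fm
□² φ = □ □ φ

□²-mono : 12g (φ →′ ψ) → 12g (□² φ →′ □² ψ)
□²-mono = □-mono ∘ □-mono

axB²-dual : ∀ φ → 12g (φ →′ □² (¬′ □² (¬′ φ)))
axB²-dual φ = 12g-trans (axB-dual φ) (12g-trans (□-mono (axB-dual (◇ φ)))
                (□²-mono (contraposition (□-mono ¬¬-intro))))

_⟶⟨_⟩_ : Theory → (Fm → Fm) → Theory → Set
Γ ⟶⟨ M ⟩ Δ = ∀ {φ} → Γ (M φ) → Δ φ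

module MC = MaximalConsistent

private variable
  M : Fm → Fm

⟶-sym : (∀ {φ ψ} → 12g (φ →′ ψ) → 12g (M φ →′ M ψ)) → (∀ φ → 12g (φ →′ M (¬′ M (¬′ φ)))) →
        MaximalConsistent Γ → MaximalConsistent Δ → Γ ⟶⟨ M ⟩ Δ → Δ ⟶⟨ M ⟩ Γ
⟶-sym mono B mΓ mΔ ΓΔ {φ} p with MC.complete mΓ φ
... | inj₁ q  = q
... | inj₂ ¬q = ⊥-elim (MC.¬-elim mΔ (ΓΔ (MC.closed mΓ (B (¬′ φ)) ¬q)) (MC.closed mΔ (mono ¬¬-intro) p))

⟶¹-sym : MaximalConsistent Γ → MaximalConsistent Δ → Γ ⟶⟨ □_ ⟩ Δ → Δ ⟶⟨ □_ ⟩ Γ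
⟶¹-sym = ⟶-sym □-mono axB-dual

⟶²-sym : MaximalConsistent Γ → MaximalConsistent Δ → Γ ⟶⟨ □² ⟩ Δ → Δ ⟶⟨ □² ⟩ Γ
⟶²-sym = ⟶-sym □²-mono axB²-dual

⟶²-refl : MaximalConsistent Γ → Γ ⟶⟨ □² ⟩ Γ
⟶²-refl {Γ} mΓ {φ} = MC.closed mΓ (12g-taut₂ (axD (□ φ)) (axB φ) λ d b → →⁺ (→⁻ b ∘ →⁻ d))

⟶⁴⇒⟶² : MaximalConsistent Γ → Γ ⟶⟨ □² ∘ □² ⟩ Δ → Γ ⟶⟨ □² ⟩ Δ
⟶⁴⇒⟶² mΓ ΓΔ = ΓΔ ∘ MC.closed mΓ (ax24 _)

⟶²-trans : MaximalConsistent Γ → Γ ⟶⟨ □² ⟩ Δ → Δ ⟶⟨ □² ⟩ Θ → Γ ⟶⟨ □² ⟩ Θ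
⟶²-trans mΓ ΓΔ ΔΘ = ⟶⁴⇒⟶² mΓ (ΔΘ ∘ ΓΔ)

boxes : Theory → Theory
boxes Γ φ = Γ (□ φ)

boxes-∪-consistent : MaximalConsistent Γ → (∀ βs → All A βs → Γ (◇ ⋀ βs)) → Consistent (boxes Γ ∪ A)
boxes-∪-consistent mΓ h φs ps ⊢¬φs =
  let αs , βs , as , bs , split = All-∪-split ps
      ⊢αs→¬βs = 12g-taut₁ ⊢¬φs λ ¬φs → →⁺ λ a → ¬⁺ λ b →
                   ¬⁻ ¬φs (⋀⁺ (split (⋀⁻ {φs = αs} a) (⋀⁻ {φs = βs} b)))
  in MC.¬-elim mΓ (h βs bs) (MC.closed mΓ (□-⋀ αs ⊢αs→¬βs) (MC.⋀-intro mΓ (map⁺ as)))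

witnesses : Theory → Fm → Theory
witnesses Γ ψ = boxes Γ ∪ λ φ → φ ≡ ψ × Γ (◇ ψ)

witnesses-consistent : MaximalConsistent Γ → ∀ ψ → Consistent (witnesses Γ ψ)
witnesses-consistent mΓ ψ = boxes-∪-consistent mΓ λ where
  []                      _ → MC.theorem mΓ (mp (nec (12g-taut ⊤⁺)) (axD ⊤′))
  (_ ∷ βs) ps@((_ , ◇ψ) ∷ _) →
    MC.closed mΓ (◇-mono (12g-taut (→⁺ (⋀⁺ ∘ All-｛｝ (All.map proj₁ ps))))) ◇ψ

join-consistent : MaximalConsistent Γ → MaximalConsistent Δ → Δ ⟶⟨ □² ⟩ Γ →
                  Consistent (boxes Γ ∪ boxes Δ)
join-consistent mΓ mΔ ΔΓ = boxes-∪-consistent mΓ λ βs bs →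
  ΔΓ (MC.closed mΔ (□-mono (axB-dual _))
        (MC.closed mΔ (□-⋀ βs (12g-taut (→⁺ id))) (MC.⋀-intro mΔ (map⁺ bs))))

data Comparison : Set where
  less equal greater : Comparison

reverse : Comparison → Comparison
reverse less    = greater
reverse equal   = equal
reverse greater = less

_then_ : Comparison → Comparison → Comparison
less    then _ = less
equal   then o = o
greater then _ = greater

then-equal : ∀ o o′ → o then o′ ≡ equal → o ≡ equal × o′ ≡ equal
then-equal equal _ e = refl , e

reverse-then : ∀ o o′ → reverse o then reverse o′ ≡ reverse (o then o′)
reverse-then less    _ = refl
reverse-then equal   _ = refl
reverse-then greater _ = refl

record Comparator (A : Set) : Set where
  field
    compare         : A → A → Comparison
    compare-equal   : ∀ a b → compare a b ≡ equal → a ≡ b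
    compare-reverse : ∀ a b → compare b a ≡ reverse (compare a b)

  _≺_ : A → A → Set
  a ≺ b = compare a b ≡ less

  ≺-asym : ∀ {a b} → a ≺ b → ¬ b ≺ a
  ≺-asym {a} {b} a≺b b≺a with () ← trans (sym b≺a) (trans (compare-reverse a b) (cong reverse a≺b))

  ≺-irrefl : ∀ {a} → ¬ a ≺ a
  ≺-irrefl a≺a = ≺-asym a≺a a≺a

  ≺-trichotomous : ∀ a b → a ≡ b ⊎ a ≺ b ⊎ b ≺ a
  ≺-trichotomous a b with compare a b in e
  ... | less    = inj₂ (inj₁ refl)
  ... | equal   = inj₁ (compare-equal a b e)
  ... | greater = inj₂ (inj₂ (trans (compare-reverse a b) (cong reverse e)))

open Comparator using (compare; compare-equal; compare-reverse)

⊤-comparator : Comparator ⊤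
⊤-comparator = record
  { compare = λ _ _ → equal ; compare-equal = λ _ _ _ → refl ; compare-reverse = λ _ _ → refl }

compareℕ : ℕ → ℕ → Comparison
compareℕ zero    zero    = equal
compareℕ zero    (suc _) = less
compareℕ (suc _) zero    = greater
compareℕ (suc m) (suc n) = compareℕ m n

ℕ-comparator : Comparator ℕ
ℕ-comparator = record { compare = compareℕ ; compare-equal = equal′ ; compare-reverse = reverse′ }
  where
  equal′ : ∀ m n → compareℕ m n ≡ equal → m ≡ n
  equal′ zero    zero    _ = refl
  equal′ (suc m) (suc n) e = cong suc (equal′ m n e)

  reverse′ : ∀ m n → compareℕ n m ≡ reverse (compareℕ m n)
  reverse′ zero    zero    = refl
  reverse′ zero    (suc _) = refl
  reverse′ (suc _) zero    = refl
  reverse′ (suc m) (suc n) = reverse′ m n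

module _ {A B : Set} (CA : Comparator A) (CB : Comparator B) where

  ⊎-comparator : Comparator (A ⊎ B)
  ⊎-comparator = record { compare = compare′ ; compare-equal = equal′ ; compare-reverse = reverse′ }
    where
    compare′ : A ⊎ B → A ⊎ B → Comparison
    compare′ (inj₁ a) (inj₁ a′) = compare CA a a′
    compare′ (inj₁ _) (inj₂ _)  = less
    compare′ (inj₂ _) (inj₁ _)  = greater
    compare′ (inj₂ b) (inj₂ b′) = compare CB b b′

    equal′ : ∀ x y → compare′ x y ≡ equal → x ≡ y
    equal′ (inj₁ a) (inj₁ a′) e = cong inj₁ (compare-equal CA a a′ e)
    equal′ (inj₂ b) (inj₂ b′) e = cong inj₂ (compare-equal CB b b′ e)

    reverse′ : ∀ x y → compare′ y x ≡ reverse (compare′ x y)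
    reverse′ (inj₁ a) (inj₁ a′) = compare-reverse CA a a′
    reverse′ (inj₁ _) (inj₂ _)  = refl
    reverse′ (inj₂ _) (inj₁ _)  = refl
    reverse′ (inj₂ b) (inj₂ b′) = compare-reverse CB b b′

  ×-comparator : Comparator (A × B)
  ×-comparator = record { compare = compare′ ; compare-equal = equal′ ; compare-reverse = reverse′ }
    where
    compare′ : A × B → A × B → Comparison
    compare′ (a , b) (a′ , b′) = compare CA a a′ then compare CB b b′

    equal′ : ∀ x y → compare′ x y ≡ equal → x ≡ y
    equal′ (a , b) (a′ , b′) e with then-equal _ _ e
    ... | e₁ , e₂ with refl ← compare-equal CA a a′ e₁ | refl ← compare-equal CB b b′ e₂ = refl

    reverse′ : ∀ x y → compare′ y x ≡ reverse (compare′ x y)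
    reverse′ (a , b) (a′ , b′)
      rewrite compare-reverse CA a a′ | compare-reverse CB b b′ =
      reverse-then (compare CA a a′) (compare CB b b′)

injective-comparator : {A B : Set} (f : A → B) → (∀ {a b} → f a ≡ f b → a ≡ b) →
                       Comparator B → Comparator A
injective-comparator f f-inj CB = record
  { compare         = λ a b → compare CB (f a) (f b)
  ; compare-equal   = λ a b → f-inj ∘ compare-equal CB (f a) (f b)
  ; compare-reverse = λ a b → compare-reverse CB (f a) (f b)
  }

Fm-comparator : Comparator Fm
Fm-comparator = record { compare = compareFm ; compare-equal = equal′ ; compare-reverse = reverse′ }
  where
  compareFm : Fm → Fm → Comparison
  compareFm (var m)   (var n)   = compareℕ m n
  compareFm (¬′ φ)    (¬′ ψ)    = compareFm φ ψ
  compareFm (φ ∧′ φ′) (ψ ∧′ ψ′) = compareFm φ ψ then compareFm φ′ ψ′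
  compareFm (□ φ)     (□ ψ)     = compareFm φ ψ
  compareFm (var _)   _         = less
  compareFm _         (var _)   = greater
  compareFm (¬′ _)    _         = less
  compareFm _         (¬′ _)    = greater
  compareFm (_ ∧′ _)  _         = less
  compareFm _         (_ ∧′ _)  = greater

  equal′ : ∀ φ ψ → compareFm φ ψ ≡ equal → φ ≡ ψ
  equal′ (var m)   (var n)   e = cong var (compare-equal ℕ-comparator m n e)
  equal′ (¬′ φ)    (¬′ ψ)    e = cong ¬′_ (equal′ φ ψ e)
  equal′ (φ ∧′ φ′) (ψ ∧′ ψ′) e with then-equal (compareFm φ ψ) _ e
  ... | e₁ , e₂ with refl ← equal′ φ ψ e₁ | refl ← equal′ φ′ ψ′ e₂ = refl
  equal′ (□ φ)     (□ ψ)     e = cong □_ (equal′ φ ψ e)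
  equal′ (var _)   (¬′ _)    ()
  equal′ (var _)   (_ ∧′ _)  ()
  equal′ (var _)   (□ _)     ()
  equal′ (¬′ _)    (var _)   ()
  equal′ (¬′ _)    (_ ∧′ _)  ()
  equal′ (¬′ _)    (□ _)     ()
  equal′ (_ ∧′ _)  (var _)   ()
  equal′ (_ ∧′ _)  (¬′ _)    ()
  equal′ (_ ∧′ _)  (□ _)     ()
  equal′ (□ _)     (var _)   ()
  equal′ (□ _)     (¬′ _)    ()
  equal′ (□ _)     (_ ∧′ _)  ()

  reverse′ : ∀ φ ψ → compareFm ψ φ ≡ reverse (compareFm φ ψ)
  reverse′ (var m)   (var n)   = compare-reverse ℕ-comparator m n
  reverse′ (¬′ φ)    (¬′ ψ)    = reverse′ φ ψ
  reverse′ (φ ∧′ φ′) (ψ ∧′ ψ′)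
    rewrite reverse′ φ ψ | reverse′ φ′ ψ′ = reverse-then (compareFm φ ψ) (compareFm φ′ ψ′)
  reverse′ (□ φ)     (□ ψ)     = reverse′ φ ψ
  reverse′ (var _)   (¬′ _)    = refl
  reverse′ (var _)   (_ ∧′ _)  = refl
  reverse′ (var _)   (□ _)     = refl
  reverse′ (¬′ _)    (var _)   = refl
  reverse′ (¬′ _)    (_ ∧′ _)  = refl
  reverse′ (¬′ _)    (□ _)     = refl
  reverse′ (_ ∧′ _)  (var _)   = refl
  reverse′ (_ ∧′ _)  (¬′ _)    = refl
  reverse′ (_ ∧′ _)  (□ _)     = refl
  reverse′ (□ _)     (var _)   = refl
  reverse′ (□ _)     (¬′ _)    = refl
  reverse′ (□ _)     (_ ∧′ _)  = refl

-- The plane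

record Stage : Set₁ where
  field
    Point      : Set
    _◁_        : Point → Point → Set
    sort       : Point → Bool
    comparator : Comparator Point

  open Comparator comparator public using (_≺_)

  Adjacent : Point → Point → Set
  Adjacent a b = a ◁ b ⊎ b ◁ a

  HaveCommonNeighbour : Point → Point → Set
  HaveCommonNeighbour a b = ∃ λ c → Adjacent a c × Adjacent c b

module _ (S : Stage) where
  open Stage S

  -- Joins are only made for p ≺ q and their proof fields are irrelevant, so a pair of points has at
  -- most one join.
  data New : Set where
    witness : Point → Fm → New
    join    : (p q : Point) → .(p ≺ q) → .(sort p ≡ sort q) → .(¬ HaveCommonNeighbour p q) → New

module _ {S : Stage} where
  open Stage S

  _◁ᴺ_ : Point → New S → Set
  a ◁ᴺ witness s _     = a ≡ s
  a ◁ᴺ join p q _ _ _ = a ≡ p ⊎ a ≡ q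

  sortᴺ : New S → Bool
  sortᴺ (witness s _)    = not (sort s)
  sortᴺ (join p _ _ _ _) = not (sort p)

  ◁ᴺ-sort : ∀ {a x} → a ◁ᴺ x → sortᴺ x ≡ not (sort a)
  ◁ᴺ-sort {x = witness _ _}      refl        = refl
  ◁ᴺ-sort {x = join _ _ _ _ _}   (inj₁ refl) = refl
  ◁ᴺ-sort {x = join p q _ p~q _} (inj₂ refl) = cong not (recompute (sort p Bool.≟ sort q) p~q)

  New-comparator : Comparator (New S)
  New-comparator = injective-comparator code code-injective
    (⊎-comparator (×-comparator comparator Fm-comparator) (×-comparator comparator comparator))
    where
    code : New S → (Point × Fm) ⊎ (Point × Point)
    code (witness s ψ)    = inj₁ (s , ψ)
    code (join p q _ _ _) = inj₂ (p , q)

    code-injective : ∀ {x y} → code x ≡ code y → x ≡ y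
    code-injective {witness _ _}    {witness _ _}    refl = refl
    code-injective {join _ _ _ _ _} {join _ _ _ _ _} refl = refl

extend : Stage → Stage
extend S = record
  { Point      = Point ⊎ New S
  ; _◁_        = _◁⁺_
  ; sort       = [ sort , sortᴺ ]
  ; comparator = ⊎-comparator comparator New-comparator
  }
  where
  open Stage S
  _◁⁺_ : Point ⊎ New S → Point ⊎ New S → Set
  inj₁ a ◁⁺ inj₁ b = a ◁ b
  inj₁ a ◁⁺ inj₂ x = a ◁ᴺ x
  inj₂ _ ◁⁺ _      = ⊥

stage : ℕ → Stage
stage zero    = record { Point = ⊤ ; _◁_ = λ _ _ → ⊥ ; sort = λ _ → false ; comparator = ⊤-comparator }
stage (suc n) = extend (stage n)

module Stageₙ (n : ℕ) = Stage (stage n)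

Born : ℕ → Set
Born zero    = ⊤
Born (suc n) = New (stage n)

Point : Set
Point = Σ ℕ Born

gen : Point → ℕ
gen = proj₁

lift : ∀ n → Stageₙ.Point n → Point
lift zero    tt       = zero , tt
lift (suc n) (inj₁ a) = lift n a
lift (suc n) (inj₂ x) = suc n , x

_◁_ : Point → Point → Set
a ◁ (zero  , _) = ⊥
a ◁ (suc n , x) = ∃ λ s → s ◁ᴺ x × lift n s ≡ a

I : Point → Point → Set
I a b = a ◁ b ⊎ b ◁ a

sort : Point → Bool
sort (zero  , _) = false
sort (suc n , x) = sortᴺ x

gen-lift : ∀ n s → gen (lift n s) ≤ n
gen-lift zero    tt       = z≤n
gen-lift (suc n) (inj₁ a) = m≤n⇒m≤1+n (gen-lift n a)
gen-lift (suc n) (inj₂ _) = ≤-refl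

◁-gen : ∀ {a b} → a ◁ b → gen a < gen b
◁-gen {b = suc n , _} (s , _ , refl) = s≤s (gen-lift n s)

lift-injective : ∀ n {s t} → lift n s ≡ lift n t → s ≡ t
lift-injective zero    {tt}     {tt}     _    = refl
lift-injective (suc n) {inj₁ a} {inj₁ b} e    = cong inj₁ (lift-injective n e)
lift-injective (suc n) {inj₁ a} {inj₂ _} e    = ⊥-elim (1+n≰n (subst (λ c → gen c ≤ n) e (gen-lift n a)))
lift-injective (suc n) {inj₂ _} {inj₁ b} e    = ⊥-elim (1+n≰n (subst (λ c → gen c ≤ n) (sym e) (gen-lift n b)))
lift-injective (suc n) {inj₂ _} {inj₂ _} refl = refl

lift-onto : ∀ n a → gen a ≤ n → ∃ λ s → lift n s ≡ a
lift-onto zero    (zero  , tt) _ = tt , refl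
lift-onto (suc n) (m , x) m≤1+n with m ≟ suc n
... | yes refl = inj₂ x , refl
... | no m≢1+n = let s , e = lift-onto n (m , x) (≤-pred (≤∧≢⇒< m≤1+n m≢1+n)) in inj₁ s , e

lift-◁⁺ : ∀ n {s t} → Stageₙ._◁_ n s t → lift n s ◁ lift n t
lift-◁⁺ (suc n) {inj₁ a} {inj₁ b} a◁b = lift-◁⁺ n a◁b
lift-◁⁺ (suc n) {inj₁ a} {inj₂ x} a◁x = a , a◁x , refl

◁-new : ∀ {n u} {z : New (stage n)} → lift n u ◁ (suc n , z) → u ◁ᴺ z
◁-new {n} {z = z} (s , s◁z , e) = subst (_◁ᴺ z) (lift-injective n e) s◁z

lift-◁⁻ : ∀ n {s t} → lift n s ◁ lift n t → Stageₙ._◁_ n s t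
lift-◁⁻ (suc n) {inj₁ a} {inj₁ b} a◁b           = lift-◁⁻ n a◁b
lift-◁⁻ (suc n) {inj₁ a} {inj₂ x} a◁x           = ◁-new {n} a◁x
lift-◁⁻ (suc n) {inj₂ x} {t}      x◁t           = ⊥-elim (<-irrefl refl (<-≤-trans (◁-gen x◁t) (gen-lift (suc n) t)))

sort-lift : ∀ n s → sort (lift n s) ≡ Stageₙ.sort n s
sort-lift zero    tt       = refl
sort-lift (suc n) (inj₁ a) = sort-lift n a
sort-lift (suc n) (inj₂ x) = refl

◁-sort : ∀ {a b} → a ◁ b → sort b ≡ not (sort a)
◁-sort {b = suc n , _} (s , s◁x , refl) = trans (◁ᴺ-sort s◁x) (cong not (sym (sort-lift n s)))

I-sym : ∀ {a b} → I a b → I b a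
I-sym = swap

I-sort : ∀ {a b} → I a b → sort b ≡ not (sort a)
I-sort (inj₁ a◁b) = ◁-sort a◁b
I-sort (inj₂ b◁a) = sym (trans (cong not (◁-sort b◁a)) (not-involutive _))

I⇒◁ : ∀ {a b} → I a b → gen b ≤ gen a → b ◁ a
I⇒◁ (inj₁ a◁b) b≤a = ⊥-elim (<⇒≱ (◁-gen a◁b) b≤a)
I⇒◁ (inj₂ b◁a) _   = b◁a

lift-adjacent⁻ : ∀ n {s t} → I (lift n s) (lift n t) → Stageₙ.Adjacent n s t
lift-adjacent⁻ n = ⊎-map (lift-◁⁻ n) (lift-◁⁻ n)

module Comparatorₙ (n : ℕ) = Comparator (Stageₙ.comparator n)

two-parents-join : ∀ {n u v} {z : New (stage n)} .{u≺v : Stageₙ._≺_ n u v} .{u~v ¬uv} →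
                   u ◁ᴺ z → v ◁ᴺ z → z ≡ join u v u≺v u~v ¬uv
two-parents-join {n} {z = witness _ _}    {u≺v} refl        refl        = ⊥-elimᵢ (Comparatorₙ.≺-irrefl n u≺v)
two-parents-join {n} {z = join _ _ _ _ _} {u≺v} (inj₁ refl) (inj₁ refl) = ⊥-elimᵢ (Comparatorₙ.≺-irrefl n u≺v)
two-parents-join {n} {z = join _ _ _ _ _} {u≺v} (inj₂ refl) (inj₂ refl) = ⊥-elimᵢ (Comparatorₙ.≺-irrefl n u≺v)
two-parents-join     {z = join _ _ _ _ _}       (inj₁ refl) (inj₂ refl) = refl
two-parents-join {n} {z = join _ _ v≺u _ _} {u≺v} (inj₂ refl) (inj₁ refl) =
  ⊥-elimᵢ (Comparatorₙ.≺-asym n u≺v v≺u)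

-- The parents of a join had no common neighbour at the stage before the join was added.
join-neighbour : ∀ {n u v} .{u≺v : Stageₙ._≺_ n u v} .{u~v ¬uv} y →
                 I (lift n u) y → I y (lift n v) → gen y ≤ suc n → y ≢ (suc n , join u v u≺v u~v ¬uv) → ⊥
join-neighbour {n} {u} {v} {¬uv = ¬uv} y uy yv y≤1+n y≢x with gen y ≟ suc n
... | no y≢1+n =
  let s , e = lift-onto n y (≤-pred (≤∧≢⇒< y≤1+n y≢1+n))
      us = lift-adjacent⁻ n (subst (I (lift n u)) (sym e) uy)
      sv = lift-adjacent⁻ n (subst (λ c → I c (lift n v)) (sym e) yv)
  in ⊥-elimᵢ (¬uv (s , us , sv))
join-neighbour {n} {u} {v} (_ , z) uy yv _ y≢x | yes refl =
  y≢x (cong (suc n ,_) (two-parents-join {n} (◁-new {n} (I⇒◁ (I-sym uy) (m≤n⇒m≤1+n (gen-lift n u))))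
                                              (◁-new {n} (I⇒◁ yv (m≤n⇒m≤1+n (gen-lift n v))))))

no-square-youngest-first : ∀ {x p y q} → I x p → I p y → I y q → I q x → x ≢ y → p ≢ q →
                      gen p ≤ gen x → gen y ≤ gen x → gen q ≤ gen x → ⊥
no-square-youngest-first xp py yq qx x≢y p≢q p≤x y≤x q≤x
  with I⇒◁ xp p≤x | I⇒◁ (I-sym qx) q≤x
no-square-youngest-first {suc n , witness _ _} _ _ _ _ _ p≢q _ _ _
  | _ , refl , refl | _ , refl , refl = p≢q refl
no-square-youngest-first {suc n , join _ _ _ _ _} _ _ _ _ _ p≢q _ _ _
  | _ , inj₁ refl , refl | _ , inj₁ refl , refl = p≢q refl
no-square-youngest-first {suc n , join _ _ _ _ _} _ _ _ _ _ p≢q _ _ _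
  | _ , inj₂ refl , refl | _ , inj₂ refl , refl = p≢q refl
no-square-youngest-first {suc n , join _ _ _ _ _} _ py yq _ x≢y _ _ y≤x _
  | _ , inj₁ refl , refl | _ , inj₂ refl , refl = join-neighbour _ py yq y≤x (x≢y ∘ sym)
no-square-youngest-first {suc n , join _ _ _ _ _} _ py yq _ x≢y _ _ y≤x _
  | _ , inj₂ refl , refl | _ , inj₁ refl , refl = join-neighbour _ (I-sym yq) (I-sym py) y≤x (x≢y ∘ sym)

no-square-gen-c≤gen-a : ∀ {a b c d} → I a b → I b c → I c d → I d a → a ≢ c → b ≢ d → gen c ≤ gen a → ⊥
no-square-gen-c≤gen-a {a} {b} {c} {d} ab bc cd da a≢c b≢d c≤a with ≤-total (gen d) (gen b)
... | inj₁ d≤b with ≤-total (gen b) (gen a)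
...   | inj₁ b≤a = no-square-youngest-first ab bc cd da a≢c b≢d b≤a c≤a (≤-trans d≤b b≤a)
...   | inj₂ a≤b = no-square-youngest-first bc cd da ab b≢d (a≢c ∘ sym) (≤-trans c≤a a≤b) d≤b a≤b
no-square-gen-c≤gen-a {a} {b} {c} {d} ab bc cd da a≢c b≢d c≤a | inj₂ b≤d with ≤-total (gen d) (gen a)
...   | inj₁ d≤a = no-square-youngest-first ab bc cd da a≢c b≢d (≤-trans b≤d d≤a) c≤a d≤a
...   | inj₂ a≤d = no-square-youngest-first da ab bc cd (b≢d ∘ sym) a≢c a≤d b≤d (≤-trans c≤a a≤d)

no-square : ∀ {a b c d} → I a b → I b c → I c d → I d a → a ≢ c → b ≢ d → ⊥
no-square {a} {c = c} ab bc cd da a≢c b≢d with ≤-total (gen c) (gen a)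
... | inj₁ c≤a = no-square-gen-c≤gen-a ab bc cd da a≢c b≢d c≤a
... | inj₂ a≤c = no-square-gen-c≤gen-a cd da ab bc (a≢c ∘ sym) (b≢d ∘ sym) a≤c

plane : Frame
plane = record { X = Point ; I = I }

root : Point
root = zero , tt

top : (a : Point) → Stageₙ.Point (gen a)
top (zero  , tt) = tt
top (suc n , x)  = inj₂ x

lift-top : ∀ a → lift (gen a) (top a) ≡ a
lift-top (zero  , tt) = refl
lift-top (suc n , x)  = refl

witness-for : Point → Fm → Point
witness-for a ψ = suc (gen a) , witness (top a) ψ

I-witness-for : ∀ a ψ → I a (witness-for a ψ)
I-witness-for a ψ = inj₁ (top a , refl , lift-top a)

child : Point → Point
child a = witness-for a (var 0)

I-child : ∀ a → I a (child a)
I-child a = I-witness-for a (var 0)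

I²-sym : ∀ {a b} → Iter I 2 a b → Iter I 2 b a
I²-sym {a} (c , ac , d , cd , refl) = c , I-sym cd , a , I-sym ac , refl

I²-sort : ∀ {a b} → Iter I 2 a b → sort a ≡ sort b
I²-sort {a} (c , ac , d , cd , refl) = sym (trans (I-sort cd) (trans (cong not (I-sort ac)) (not-involutive (sort a))))

lift-adjacent⁺ : ∀ n {s t} → Stageₙ.Adjacent n s t → I (lift n s) (lift n t)
lift-adjacent⁺ n = ⊎-map (lift-◁⁺ n) (lift-◁⁺ n)

module Classical (em : ExcludedMiddle 0ℓ) where

  -- Two points of equal sort with no common neighbour yet were joined at the next stage.
  lift-≺-I² : ∀ n {u v} → Stageₙ._≺_ n u v → Stageₙ.sort n u ≡ Stageₙ.sort n v →
              Iter I 2 (lift n u) (lift n v)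
  lift-≺-I² n {u} {v} u≺v u~v with em {Stageₙ.HaveCommonNeighbour n u v}
  ... | yes (w , uw , wv) = lift n w , lift-adjacent⁺ n uw , lift n v , lift-adjacent⁺ n wv , refl
  ... | no ¬uv = (suc n , join u v u≺v u~v ¬uv) , inj₁ (u , inj₁ refl , refl) ,
                 lift n v , inj₂ (v , inj₂ refl , refl) , refl

  lift-I² : ∀ n u v → Stageₙ.sort n u ≡ Stageₙ.sort n v → Iter I 2 (lift n u) (lift n v)
  lift-I² n u v u~v with Comparatorₙ.≺-trichotomous n u v
  ... | inj₁ refl        = child (lift n u) , I-child _ , lift n u , I-sym (I-child _) , refl
  ... | inj₂ (inj₁ u≺v) = lift-≺-I² n u≺v u~v
  ... | inj₂ (inj₂ v≺u) = I²-sym (lift-≺-I² n v≺u (sym u~v))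

  sort-I² : ∀ a b → sort a ≡ sort b → Iter I 2 a b
  sort-I² a b a~b =
    let n = gen a ⊔ gen b
        u , eu = lift-onto n a (m≤m⊔n (gen a) (gen b))
        v , ev = lift-onto n b (m≤n⊔m (gen a) (gen b))
        u~v = subst₂ (λ x y → sort x ≡ sort y) (sym eu) (sym ev) a~b
    in subst₂ (Iter I 2) eu ev (lift-I² n u v (trans (sym (sort-lift n u)) (trans u~v (sort-lift n v))))

  O1-plane : O1 plane
  O1-plane a b (c , ac , d , cd , d⇝b) = sort-I² a b (trans (I²-sort (c , ac , d , cd , refl)) (I²-sort d⇝b))

  O2-plane : O2 plane
  O2-plane a b with sort a Bool.≟ sort b
  ... | yes a~b = inj₁ (sort-I² a b a~b)
  ... | no a≁b  =
    inj₂ (child a , I-child a , sort-I² (child a) b (trans (I-sort (I-child a)) (sym (¬-not (a≁b ∘ sym)))))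

  O3-plane : O3 plane
  O3-plane a b c d ab bc cd da with em {a ≡ c} | em {b ≡ d}
  ... | yes a≡c | _       = inj₁ a≡c
  ... | no _    | yes b≡d = inj₂ b≡d
  ... | no a≢c  | no b≢d  = ⊥-elim (no-square ab bc cd da a≢c b≢d)

  projective-plane : Projective plane
  projective-plane = root , child root , (λ r⇝c → case I²-sort r⇝c of λ ()) , classify
    where
    classify : ∀ z → Iter I 2 z root ⊎ Iter I 2 z (child root)
    classify z with sort z in z~
    ... | false = inj₁ (sort-I² z root z~)
    ... | true  = inj₂ (sort-I² z (child root) z~)

◁-child : ∀ {a b} → a ◁ child b → a ≡ b
◁-child {b = b} (_ , refl , e) = trans (sym e) (lift-top b)

¬I-children : ∀ a b → child a ≢ b → child b ≢ a → ¬ I (child a) (child b)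
¬I-children _ _ a′≢b _    (inj₁ a′◁b′) = a′≢b (◁-child a′◁b′)
¬I-children _ _ _    b′≢a (inj₂ b′◁a′) = b′≢a (◁-child b′◁a′)

¬I-root : ∀ b → root ≢ b → ¬ I root (child b)
¬I-root _ r≢b (inj₁ r◁b′) = r≢b (◁-child r◁b′)

¬I⇒¬Incident : ∀ {a b} → ¬ I a b → ¬ Incident plane a b
¬I⇒¬Incident ¬ab (inj₁ ab) = ¬ab ab
¬I⇒¬Incident ¬ab (inj₂ ba) = ¬ab (I-sym ba)

¬Incident-root : ∀ b → root ≢ b → ¬ Incident plane root (child b)
¬Incident-root b r≢b = ¬I⇒¬Incident {root} {child b} (¬I-root b r≢b)

¬Incident-children : ∀ a b → child a ≢ b → child b ≢ a → ¬ Incident plane (child a) (child b)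
¬Incident-children a b a′≢b b′≢a = ¬I⇒¬Incident {child a} {child b} (¬I-children a b a′≢b b′≢a)

non-degenerate-plane : NonDegenerate plane
non-degenerate-plane =
  a , b , c , d , e , f , I-child a , I-child b , I-child c , I-child e , ¬I-root c (λ ()) ,
  ¬Incident-root e′ (λ ()) , ¬Incident-root e (λ ()) ,
  ¬Incident-children a e′ (λ ()) (λ ()) , ¬Incident-children a e (λ ()) (λ ()) ,
  ¬Incident-children b e′ (λ ()) (λ ()) , ¬Incident-children b e (λ ()) (λ ()) ,
  ¬Incident-children c e′ (λ ()) (λ ()) , ¬Incident-children c e (λ ()) (λ ())
  where
  a b c d e′ e f : Point
  a  = root
  b  = child a
  c  = child b
  d  = child c
  e′ = witness-for root (var 1)
  e  = child e′
  f  = child e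

-- The canonical labelling

module CanonicalModel (em : ExcludedMiddle 0ℓ) (S : Theory) (S-consistent : Consistent S) where
  open Lindenbaum em
  open Equivalence using (to; from)

  labelₙ : ∀ n → Stageₙ.Point n → Theory
  labelₙ zero    tt                      = maximise S
  labelₙ (suc n) (inj₁ a)                = labelₙ n a
  labelₙ (suc n) (inj₂ (witness s ψ))    = maximise (witnesses (labelₙ n s) ψ)
  labelₙ (suc n) (inj₂ (join p q _ _ _)) = maximise (boxes (labelₙ n p) ∪ boxes (labelₙ n q))

  label : Point → Theory
  label a = labelₙ (gen a) (top a)

  label-lift : ∀ n s → label (lift n s) ≡ labelₙ n s
  label-lift zero    tt       = refl
  label-lift (suc n) (inj₁ a) = label-lift n a
  label-lift (suc n) (inj₂ x) = refl

  ◁ᴺ⇒⟶ : ∀ n {s x} → s ◁ᴺ x → labelₙ n s ⟶⟨ □_ ⟩ labelₙ (suc n) (inj₂ x)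
  ◁ᴺ⇒⟶ n {x = witness _ _}    refl        p = maximise-⊇ _ (inj₁ p)
  ◁ᴺ⇒⟶ n {x = join _ _ _ _ _} (inj₁ refl) p = maximise-⊇ _ (inj₁ p)
  ◁ᴺ⇒⟶ n {x = join _ _ _ _ _} (inj₂ refl) p = maximise-⊇ _ (inj₂ p)

  Γ₀ Γ₁ : Theory
  Γ₀ = label root
  Γ₁ = label (child root)

  Γ₀-maximal : MaximalConsistent Γ₀
  Γ₀-maximal = maximise-maximal S S-consistent

  Γ₁-maximal : MaximalConsistent Γ₁
  Γ₁-maximal = maximise-maximal _ (witnesses-consistent Γ₀-maximal (var 0))

  anchor : Bool → Theory
  anchor false = Γ₀
  anchor true  = Γ₁

  anchor-maximal : ∀ b → MaximalConsistent (anchor b)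
  anchor-maximal false = Γ₀-maximal
  anchor-maximal true  = Γ₁-maximal

  anchor-swap : ∀ b → anchor (not b) ⟶⟨ □_ ⟩ anchor b
  anchor-swap false = ⟶¹-sym Γ₀-maximal Γ₁-maximal (◁ᴺ⇒⟶ 0 refl)
  anchor-swap true  = ◁ᴺ⇒⟶ 0 refl

  Good : ∀ n → Stageₙ.Point n → Set
  Good n s = MaximalConsistent (labelₙ n s) × anchor (Stageₙ.sort n s) ⟶⟨ □² ⟩ labelₙ n s

  good-child : ∀ n {s x} → Good n s → s ◁ᴺ x → MaximalConsistent (labelₙ (suc n) (inj₂ x)) →
               Good (suc n) (inj₂ x)
  good-child n {s} (_ , s-anchored) s◁x x-maximal rewrite ◁ᴺ-sort s◁x =
    x-maximal , ⟶⁴⇒⟶² (anchor-maximal (not (Stageₙ.sort n s)))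
                      (◁ᴺ⇒⟶ n s◁x ∘ s-anchored ∘ anchor-swap (Stageₙ.sort n s))

  same-sort-⟶² : ∀ n {p q} → Good n p → Good n q → Stageₙ.sort n p ≡ Stageₙ.sort n q →
                 labelₙ n q ⟶⟨ □² ⟩ labelₙ n p
  same-sort-⟶² n {p} {q} (_ , p-anchored) (q-maximal , q-anchored) p~q =
    ⟶²-trans q-maximal (⟶²-sym (anchor-maximal (Stageₙ.sort n q)) q-maximal q-anchored)
      (subst (λ b → anchor b ⟶⟨ □² ⟩ labelₙ n p) p~q p-anchored)

  good : ∀ n s → Good n s
  good zero    tt       = Γ₀-maximal , ⟶²-refl Γ₀-maximal
  good (suc n) (inj₁ a) = good n a
  good (suc n) (inj₂ (witness s ψ)) =
    good-child n {s} (good n s) refl (maximise-maximal _ (witnesses-consistent (proj₁ (good n s)) ψ))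
  good (suc n) (inj₂ (join p q p≺q p~q ¬pq)) =
    good-child n {p} {join p q p≺q p~q ¬pq} (good n p) (inj₁ refl)
      (maximise-maximal _ (join-consistent (proj₁ (good n p)) (proj₁ (good n q)) q⟶²p))
    where
    q⟶²p : labelₙ n q ⟶⟨ □² ⟩ labelₙ n p
    q⟶²p = same-sort-⟶² n (good n p) (good n q) (recompute (Stageₙ.sort n p Bool.≟ Stageₙ.sort n q) p~q)

  label-maximal : ∀ a → MaximalConsistent (label a)
  label-maximal a = proj₁ (good (gen a) (top a))

  ◁⇒⟶ : ∀ {a b} → a ◁ b → label a ⟶⟨ □_ ⟩ label b
  ◁⇒⟶ {b = suc n , x} (s , s◁x , refl) = ◁ᴺ⇒⟶ n s◁x ∘ subst (λ Γ → Γ (□ _)) (label-lift n s)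

  I⇒⟶ : ∀ {a b} → I a b → label a ⟶⟨ □_ ⟩ label b
  I⇒⟶         (inj₁ a◁b) = ◁⇒⟶ a◁b
  I⇒⟶ {a} {b} (inj₂ b◁a) = ⟶¹-sym (label-maximal b) (label-maximal a) (◁⇒⟶ b◁a)

  V : ℕ → Point → Set
  V k a = label a (var k)

  ◇-witness-for : ∀ a φ → label a (◇ φ) → label (witness-for a φ) φ
  ◇-witness-for a φ ◇φ = maximise-⊇ _ (inj₂ (refl , ◇φ))

  truth : ∀ φ a → Holds plane V a φ ⇔ label a φ
  truth (var k)  a = mk⇔ id id
  truth (¬′ φ)   a = mk⇔ (λ ¬h → MC.¬-intro (label-maximal a) (¬h ∘ from (truth φ a)))
                         (λ ¬p → MC.¬-elim (label-maximal a) ¬p ∘ to (truth φ a))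
  truth (φ ∧′ ψ) a = mk⇔ (λ (h , k) → MC.∧-intro (label-maximal a) (to (truth φ a) h) (to (truth ψ a) k))
                         (λ p → let q , r = MC.∧-elim (label-maximal a) p
                                in from (truth φ a) q , from (truth ψ a) r)
  truth (□ φ)    a = mk⇔ □-complete (λ p b ab → from (truth φ b) (I⇒⟶ ab p))
    where
    □-complete : Holds plane V a (□ φ) → label a (□ φ)
    □-complete h with MC.complete (label-maximal a) (□ φ)
    ... | inj₁ p  = p
    ... | inj₂ ¬p =
      let w = witness-for a (¬′ φ)
      in ⊥-elim (MC.¬-elim (label-maximal w) (◇-witness-for a (¬′ φ) (MC.closed (label-maximal a) ¬□⇒◇¬ ¬p))
                                             (to (truth φ w) (h w (I-witness-for a (¬′ φ)))))

  satisfiable : SatisfiableIn plane V S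
  satisfiable = root , λ φ p → from (truth φ root) (maximise-⊇ S p)

theorem6p1 : ExcludedMiddle 0ℓ →
    (S : Fm → Set) → Consistent S →
      Σ Frame λ F →
        Is1Plane F × Projective F × NonDegenerate F ×
        Σ (ℕ → Frame.X F → Set) λ V → SatisfiableIn F V S
theorem6p1 em S S-consistent =
  plane , (O1-plane , O2-plane , O3-plane) , projective-plane , non-degenerate-plane , V , satisfiable
  where
  open Classical em
  open CanonicalModel em S S-consistent
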